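{- Let $\lesssim$ be a plausible preorder on $\mathcal{T}$ and $E(\cdot|\cdot)$ the conditional expectation naturally induced by it; write $P(C|D)=E(C|D)$. Let $X$ be a random quantity and $C,D$ events. Suppose $E(X.C|D)=0$ and there is a real number $p$ such that $1\lesssim_{C.D}pX$. Then $P(C|D)=0$.
   Context: Random quantities: $\mathcal{T}$ is a unital associative commutative algebra over $\mathbb{R}$; reals $r$ are identified with $r\mathbf{1}$; products are written $X.Y$. Events: idempotents $A$ ($A.A=A$). Plausible preorder: a relation $\lesssim$ on $\mathcal{T}$ with (i) $0\lesssim A$ for every event $A$; (ii) $0\lesssim X$ and $0\lesssim Y$ imply $0\lesssim X+Y$; (iii) $0\lesssim X$ and real $q\ge0$ imply $0\lesssim qX$; (iv) $X\lesssim Y$ iff $0\lesssim Y-X$. Strict part: $X\lnsim Y$ iff $X\lesssim Y$ and not $Y\lesssim X$. Conditional preorder: $X\lesssim_C Y$ iff $X.C\lesssim Y.C$; strict part $\lnsim_C$. Expectation induced by a plausible preorder: $E(X)$ is the real $x$ if $-\epsilon\lnsim X-x\lnsim\epsilon$ for all reals $\epsilon>0$; it is $+\infty$ if $y\lnsim X$ for all reals $y$; it is $-\infty$ if $X\lnsim y$ for all reals $y$; it is undefined otherwise. Conditional expectation: $E(X|C)$ is the expectation induced by $\lesssim_C$. Conditional probability: $P(C|D)=E(C|D)$. -}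

module Defs where

open import Level using (Level; _⊔_) renaming (suc to lsuc)
open import Data.Product using (Σ; ∃; _×_; _,_)
open import Relation.Nullary using (¬_)
open import Relation.Binary.PropositionalEquality using (_≡_; _≢_)
open import Relation.Binary.Structures using (IsTotalOrder)
open import Algebra.Structures using (IsCommutativeRing)

-- The real numbers, axiomatised as a Dedekind-complete ordered field
-- (any model is isomorphic to ℝ).  agda-stdlib has no reals.

record Reals : Set₁ where
  infixl 6 _+_
  infixl 7 _*_
  infix 4 _≤_ _<_
  field
    ℝ   : Set
    0r 1r : ℝ
    _+_ _*_ : ℝ → ℝ → ℝ
    -_  : ℝ → ℝ
    _≤_ : ℝ → ℝ → Set
    isCommutativeRing : IsCommutativeRing _≡_ _+_ _*_ -_ 0r 1r
    0≢1     : 0r ≢ 1r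
    inverse : ∀ x → x ≢ 0r → Σ ℝ (λ y → x * y ≡ 1r)
    isTotalOrder : IsTotalOrder _≡_ _≤_
    +-mono-≤ : ∀ {x y} z → x ≤ y → x + z ≤ y + z
    *-nonneg : ∀ {x y} → 0r ≤ x → 0r ≤ y → 0r ≤ x * y
    complete : (S : ℝ → Set) → ∃ S → ∃ (λ b → ∀ s → S s → s ≤ b) →
               ∃ (λ u → (∀ s → S s → s ≤ u) ×
                        (∀ b → (∀ s → S s → s ≤ b) → u ≤ b))

  _<_ : ℝ → ℝ → Set
  x < y = x ≤ y × x ≢ y

-- Random quantities: a unital associative commutative ℝ-algebra 𝒯.

record Algebra (R : Reals) : Set₁ where
  open Reals R
  infixl 6 _⊕_
  infixl 7 _·_
  infixr 8 _▹_
  field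
    𝒯    : Set
    _⊕_ _·_ : 𝒯 → 𝒯 → 𝒯
    ⊖_   : 𝒯 → 𝒯
    𝟘 𝟙  : 𝒯
    _▹_  : ℝ → 𝒯 → 𝒯
    isCommutativeRing : IsCommutativeRing _≡_ _⊕_ _·_ ⊖_ 𝟘 𝟙
    ▹-distrib-⊕ : ∀ r X Y → r ▹ (X ⊕ Y) ≡ r ▹ X ⊕ r ▹ Y
    ▹-distrib-+ : ∀ r s X → (r + s) ▹ X ≡ r ▹ X ⊕ s ▹ X
    ▹-assoc     : ∀ r s X → (r * s) ▹ X ≡ r ▹ (s ▹ X)
    ▹-identity  : ∀ X → 1r ▹ X ≡ X
    ▹-·         : ∀ r X Y → (r ▹ X) · Y ≡ r ▹ (X · Y)

  ι : ℝ → 𝒯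
  ι r = r ▹ 𝟙

  _⊝_ : 𝒯 → 𝒯 → 𝒯
  X ⊝ Y = X ⊕ (⊖ Y)

  IsEvent : 𝒯 → Set
  IsEvent A = A · A ≡ A

module _ {R : Reals} (𝒜 : Algebra R) where
  open Reals R
  open Algebra 𝒜

  record IsPlausiblePreorder (_≲_ : 𝒯 → 𝒯 → Set) : Set where
    field
      events-nonneg : ∀ A → IsEvent A → ι 0r ≲ A
      nonneg-+      : ∀ X Y → ι 0r ≲ X → ι 0r ≲ Y → ι 0r ≲ (X ⊕ Y)
      nonneg-scale  : ∀ X q → 0r ≤ q → ι 0r ≲ X → ι 0r ≲ (q ▹ X)
      ≲⇒diff        : ∀ X Y → X ≲ Y → ι 0r ≲ (Y ⊝ X)
      diff⇒≲        : ∀ X Y → ι 0r ≲ (Y ⊝ X) → X ≲ Y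

  Strict : (𝒯 → 𝒯 → Set) → 𝒯 → 𝒯 → Set
  Strict _≲_ X Y = X ≲ Y × ¬ (Y ≲ X)

  Cond : (𝒯 → 𝒯 → Set) → 𝒯 → 𝒯 → 𝒯 → Set
  Cond _≲_ C X Y = (X · C) ≲ (Y · C)

  data ℝ̄ : Set where
    fin : ℝ → ℝ̄
    +∞ -∞ : ℝ̄

  -- "E(X) = v" for the expectation induced by the preorder _≲_.
  -- The three defining clauses are mutually exclusive, so this
  -- relation is functional; "undefined" means no v satisfies it.
  ExpectationIs : (𝒯 → 𝒯 → Set) → 𝒯 → ℝ̄ → Set
  ExpectationIs _≲_ X (fin x) =
    ∀ ε → 0r < ε → Strict _≲_ (ι (- ε)) (X ⊝ ι x) × Strict _≲_ (X ⊝ ι x) (ι ε)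
  ExpectationIs _≲_ X +∞ = ∀ y → Strict _≲_ (ι y) X
  ExpectationIs _≲_ X -∞ = ∀ y → Strict _≲_ X (ι y)

  CondExpectationIs : (𝒯 → 𝒯 → Set) → 𝒯 → 𝒯 → ℝ̄ → Set
  CondExpectationIs _≲_ X C v = ExpectationIs (Cond _≲_ C) X v

  CondProbabilityIs : (𝒯 → 𝒯 → Set) → 𝒯 → 𝒯 → ℝ̄ → Set
  CondProbabilityIs _≲_ C D v = CondExpectationIs _≲_ C D v

module Submission where

open import Defs
open import Data.Product using (Σ; ∃; _×_; _,_; proj₁; proj₂; map)
open import Data.Sum using (inj₁; inj₂)
open import Data.Empty using (⊥-elim)
open import Function.Bundles using (_⇔_; mk⇔; Equivalence)
open import Relation.Nullary using (¬_)
open import Relation.Binary.PropositionalEquality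
  using (_≡_; _≢_; sym; trans; cong; cong₂; subst; subst₂; module ≡-Reasoning)
open import Relation.Binary.Structures using (IsTotalOrder)
open import Algebra.Structures using (IsCommutativeRing)
open import Algebra.Bundles using (CommutativeRing)
import Algebra.Properties.Ring as RingProperties
import Algebra.Properties.AbelianGroup as AbelianGroupProperties
import Algebra.Properties.CommutativeSemigroup as CommutativeSemigroupProperties

-- Conditioning on D, E(X.C|D) = 0 says that W = X.C.D lies strictly between
-- -εD and εD for every ε > 0.  Consequently no positive multiple of D is ≲ 0.
-- The event V = C.D satisfies 0 ≲ V ≲ pW, and scaling the band of W by p
-- gives V ≲ |p|δD for every δ > 0.  Taking δ = ε/(1+|p|) leaves a gap δD
-- below εD, which makes both comparisons -εD ⋦ V ⋦ εD strict.

module CommutativeRingLemmas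
  {A : Set} {add mul : A → A → A} {neg : A → A} {zero one : A}
  (isCommutativeRing : IsCommutativeRing _≡_ add mul neg zero one) where

  private
    commutativeRing : CommutativeRing _ _
    commutativeRing = record { isCommutativeRing = isCommutativeRing }

  open CommutativeRing commutativeRing
    using (_+_; _*_; -_; 0#; 1#; ring; +-abelianGroup; *-commutativeSemigroup)
  open CommutativeRing commutativeRing public
    using (+-assoc; +-identityˡ; -‿inverseˡ; +-identityʳ; -‿inverseʳ;
           *-assoc; *-identityˡ; *-identityʳ; zeroʳ; distribʳ)
  open RingProperties ring public
    using (-‿distribˡ-*; -‿distribʳ-*; -1*x≈-x; x+x≈x⇒x≈0)
  open AbelianGroupProperties +-abelianGroup public
    using (inverseʳ-unique; ε⁻¹≈ε; ⁻¹-involutive; ⁻¹-anti-homo‿-; xyx⁻¹≈y)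
  open CommutativeSemigroupProperties *-commutativeSemigroup public
    using (interchange; x∙yz≈y∙xz)

  -1*-1≡1 : (- 1#) * (- 1#) ≡ 1#
  -1*-1≡1 = trans (-1*x≈-x (- 1#)) (⁻¹-involutive 1#)

  x-y+y-z≡x-z : ∀ x y z → (x + - y) + (y + - z) ≡ x + - z
  x-y+y-z≡x-z x y z = begin
    (x + - y) + (y + - z)   ≡⟨ +-assoc x (- y) (y + - z) ⟩
    x + (- y + (y + - z))   ≡⟨ cong (x +_) (sym (+-assoc (- y) y (- z))) ⟩
    x + ((- y + y) + - z)   ≡⟨ cong (λ t → x + (t + - z)) (-‿inverseˡ y) ⟩
    x + (0# + - z)          ≡⟨ cong (x +_) (+-identityˡ (- z)) ⟩
    x + - z                 ∎
    where open ≡-Reasoning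

module OrderedFieldLemmas (R : Reals) where
  open Reals R
  module ℝ = CommutativeRingLemmas isCommutativeRing
  open IsTotalOrder isTotalOrder using (total; antisym) renaming (trans to ≤-trans)

  x≤0⇒0≤-x : ∀ {x} → x ≤ 0r → 0r ≤ - x
  x≤0⇒0≤-x {x} x≤0 = subst₂ _≤_ (ℝ.-‿inverseʳ x) (ℝ.+-identityˡ (- x)) (+-mono-≤ (- x) x≤0)

  0≤1 : 0r ≤ 1r
  0≤1 with total 0r 1r
  ... | inj₁ 0≤1 = 0≤1
  ... | inj₂ 1≤0 = subst (0r ≤_) ℝ.-1*-1≡1 (*-nonneg (x≤0⇒0≤-x 1≤0) (x≤0⇒0≤-x 1≤0))

  0≰-1 : ¬ (0r ≤ - 1r)
  0≰-1 0≤-1 = 0≢1 (antisym 0≤1 1≤0)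
    where
    1≤0 : 1r ≤ 0r
    1≤0 = subst₂ _≤_ (ℝ.+-identityˡ 1r) (ℝ.-‿inverseˡ 1r) (+-mono-≤ 1r 0≤-1)

  divide-by-1+a : ∀ {a ε} → 0r ≤ a → 0r < ε → Σ ℝ λ δ → 0r < δ × a * δ + δ ≡ ε
  divide-by-1+a {a} {ε} 0≤a (0≤ε , 0≢ε) = ε * y , (*-nonneg 0≤ε 0≤y , 0≢εy) , aδ+δ≡ε
    where
    q : ℝ
    q = a + 1r
    1≤q : 1r ≤ q
    1≤q = subst (_≤ q) (ℝ.+-identityˡ 1r) (+-mono-≤ 1r 0≤a)
    q≢0 : q ≢ 0r
    q≢0 q≡0 = 0≢1 (antisym 0≤1 (subst (1r ≤_) q≡0 1≤q))
    y : ℝ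
    y = proj₁ (inverse q q≢0)
    qy≡1 : q * y ≡ 1r
    qy≡1 = proj₂ (inverse q q≢0)
    0≤y : 0r ≤ y
    0≤y with total 0r y
    ... | inj₁ 0≤y = 0≤y
    ... | inj₂ y≤0 = ⊥-elim (0≰-1 (subst (0r ≤_) q[-y]≡-1 (*-nonneg (≤-trans 0≤1 1≤q) (x≤0⇒0≤-x y≤0))))
      where
      q[-y]≡-1 : q * (- y) ≡ - 1r
      q[-y]≡-1 = trans (sym (ℝ.-‿distribʳ-* q y)) (cong -_ qy≡1)
    q[εy]≡ε : q * (ε * y) ≡ ε
    q[εy]≡ε = trans (ℝ.x∙yz≈y∙xz q ε y) (trans (cong (ε *_) qy≡1) (ℝ.*-identityʳ ε))
    0≢εy : 0r ≢ ε * y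
    0≢εy 0≡εy = 0≢ε (sym (trans (sym q[εy]≡ε) (trans (cong (q *_) (sym 0≡εy)) (ℝ.zeroʳ q))))
    aδ+δ≡ε : a * (ε * y) + ε * y ≡ ε
    aδ+δ≡ε = trans (cong (a * (ε * y) +_) (sym (ℝ.*-identityˡ (ε * y))))
                   (trans (sym (ℝ.distribʳ (ε * y) a 1r)) q[εy]≡ε)

module ScalarMultiplicationLemmas (R : Reals) (𝒜 : Algebra R) where
  open Reals R hiding (isCommutativeRing)
  open Algebra 𝒜
  open OrderedFieldLemmas R using (module ℝ)
  module 𝒯 = CommutativeRingLemmas isCommutativeRing

  ▹-zeroˡ : ∀ X → 0r ▹ X ≡ 𝟘
  ▹-zeroˡ X = 𝒯.x+x≈x⇒x≈0 (0r ▹ X)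
    (trans (sym (▹-distrib-+ 0r 0r X)) (cong (_▹ X) (ℝ.+-identityʳ 0r)))

  ▹-zeroʳ : ∀ r → r ▹ 𝟘 ≡ 𝟘
  ▹-zeroʳ r = 𝒯.x+x≈x⇒x≈0 (r ▹ 𝟘)
    (trans (sym (▹-distrib-⊕ r 𝟘 𝟘)) (cong (r ▹_) (𝒯.+-identityʳ 𝟘)))

  ▹-negˡ : ∀ r X → (- r) ▹ X ≡ ⊖ (r ▹ X)
  ▹-negˡ r X = 𝒯.inverseʳ-unique (r ▹ X) ((- r) ▹ X)
    (trans (sym (▹-distrib-+ r (- r) X)) (trans (cong (_▹ X) (ℝ.-‿inverseʳ r)) (▹-zeroˡ X)))

  ▹-negʳ : ∀ r X → r ▹ (⊖ X) ≡ ⊖ (r ▹ X)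
  ▹-negʳ r X = 𝒯.inverseʳ-unique (r ▹ X) (r ▹ ⊖ X)
    (trans (sym (▹-distrib-⊕ r X (⊖ X))) (trans (cong (r ▹_) (𝒯.-‿inverseʳ X)) (▹-zeroʳ r)))

  ▹-distrib-⊝ : ∀ r X Y → r ▹ (X ⊝ Y) ≡ (r ▹ X) ⊝ (r ▹ Y)
  ▹-distrib-⊝ r X Y = trans (▹-distrib-⊕ r X (⊖ Y)) (cong (r ▹ X ⊕_) (▹-negʳ r Y))

  ▹-distrib-− : ∀ r s X → (r + - s) ▹ X ≡ (r ▹ X) ⊝ (s ▹ X)
  ▹-distrib-− r s X = trans (▹-distrib-+ r (- s) X) (cong (r ▹ X ⊕_) (▹-negˡ s X))

  ι-zero : ι 0r ≡ 𝟘
  ι-zero = ▹-zeroˡ 𝟙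

  ι-· : ∀ r X → ι r · X ≡ r ▹ X
  ι-· r X = trans (▹-· r 𝟙 X) (cong (r ▹_) (𝒯.*-identityˡ X))

  ·-event : ∀ {A B} → IsEvent A → IsEvent B → IsEvent (A · B)
  ·-event {A} {B} AA≡A BB≡B = trans (𝒯.interchange A B A B) (cong₂ _·_ AA≡A BB≡B)

module PlausiblePreorderLemmas (R : Reals) (𝒜 : Algebra R)
  {_≲_ : Algebra.𝒯 𝒜 → Algebra.𝒯 𝒜 → Set} (isPlausible : IsPlausiblePreorder 𝒜 _≲_) where
  open Reals R hiding (isCommutativeRing)
  open Algebra 𝒜
  open OrderedFieldLemmas R
  open ScalarMultiplicationLemmas R 𝒜
  open IsPlausiblePreorder isPlausible
  open IsTotalOrder isTotalOrder using (total)

  ≲-trans : ∀ {X Y Z} → X ≲ Y → Y ≲ Z → X ≲ Z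
  ≲-trans {X} {Y} {Z} X≲Y Y≲Z = diff⇒≲ X Z
    (subst (ι 0r ≲_) (𝒯.x-y+y-z≡x-z Z Y X) (nonneg-+ _ _ (≲⇒diff Y Z Y≲Z) (≲⇒diff X Y X≲Y)))

  ≲-scale : ∀ {q X Y} → 0r ≤ q → X ≲ Y → (q ▹ X) ≲ (q ▹ Y)
  ≲-scale {q} {X} {Y} 0≤q X≲Y = diff⇒≲ _ _
    (subst (ι 0r ≲_) (▹-distrib-⊝ q Y X) (nonneg-scale _ q 0≤q (≲⇒diff X Y X≲Y)))

  ≲-scale-antitone : ∀ {q X Y} → q ≤ 0r → X ≲ Y → (q ▹ Y) ≲ (q ▹ X)
  ≲-scale-antitone {q} {X} {Y} q≤0 X≲Y = diff⇒≲ _ _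
    (subst (ι 0r ≲_) [-q][Y-X]≡qX-qY (nonneg-scale _ (- q) (x≤0⇒0≤-x q≤0) (≲⇒diff X Y X≲Y)))
    where
    [-q][Y-X]≡qX-qY : (- q) ▹ (Y ⊝ X) ≡ (q ▹ X) ⊝ (q ▹ Y)
    [-q][Y-X]≡qX-qY = begin
      (- q) ▹ (Y ⊝ X)         ≡⟨ ▹-negˡ q (Y ⊝ X) ⟩
      ⊖ (q ▹ (Y ⊝ X))         ≡⟨ cong ⊖_ (▹-distrib-⊝ q Y X) ⟩
      ⊖ ((q ▹ Y) ⊝ (q ▹ X))   ≡⟨ 𝒯.⁻¹-anti-homo‿- (q ▹ Y) (q ▹ X) ⟩
      (q ▹ X) ⊝ (q ▹ Y)       ∎
      where open ≡-Reasoning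

  0≲⊖⇒≲0 : ∀ {X} → ι 0r ≲ (⊖ X) → X ≲ ι 0r
  0≲⊖⇒≲0 {X} 0≲⊖X = diff⇒≲ X (ι 0r)
    (subst (ι 0r ≲_) (sym (trans (cong (_⊝ X) ι-zero) (𝒯.+-identityˡ (⊖ X)))) 0≲⊖X)

  0≲[s-r]▹⇒▹≲▹ : ∀ {r s Z} → ι 0r ≲ ((s + - r) ▹ Z) → (r ▹ Z) ≲ (s ▹ Z)
  0≲[s-r]▹⇒▹≲▹ {r} {s} {Z} 0≲[s-r]Z = diff⇒≲ _ _ (subst (ι 0r ≲_) (▹-distrib-− s r Z) 0≲[s-r]Z)

  ▹≲▹⇒0≲[s-r]▹ : ∀ {r s Z} → (r ▹ Z) ≲ (s ▹ Z) → ι 0r ≲ ((s + - r) ▹ Z)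
  ▹≲▹⇒0≲[s-r]▹ {r} {s} {Z} rZ≲sZ = subst (ι 0r ≲_) (sym (▹-distrib-− s r Z)) (≲⇒diff _ _ rZ≲sZ)

  Within : 𝒯 → ℝ → 𝒯 → Set
  Within D ε Y = Strict 𝒜 _≲_ ((- ε) ▹ D) Y × Strict 𝒜 _≲_ Y (ε ▹ D)

  condExpectation≡0⇔within : ∀ Y D →
    CondExpectationIs 𝒜 _≲_ Y D (fin 0r) ⇔ (∀ ε → 0r < ε → Within D ε (Y · D))
  condExpectation≡0⇔within Y D = mk⇔
    (λ E≡0 ε 0<ε → map (strict-resp (ι-· (- ε) D) [Y-0]D≡YD) (strict-resp [Y-0]D≡YD (ι-· ε D)) (E≡0 ε 0<ε))
    (λ within ε 0<ε → map (strict-resp (sym (ι-· (- ε) D)) (sym [Y-0]D≡YD))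
                          (strict-resp (sym [Y-0]D≡YD) (sym (ι-· ε D))) (within ε 0<ε))
    where
    strict-resp : ∀ {X X′ Y Y′} → X ≡ X′ → Y ≡ Y′ → Strict 𝒜 _≲_ X Y → Strict 𝒜 _≲_ X′ Y′
    strict-resp = subst₂ (Strict 𝒜 _≲_)
    [Y-0]D≡YD : (Y ⊝ ι 0r) · D ≡ Y · D
    [Y-0]D≡YD = cong (_· D)
      (trans (cong (λ Z → Y ⊝ Z) ι-zero) (trans (cong (Y ⊕_) 𝒯.ε⁻¹≈ε) (𝒯.+-identityʳ Y)))

  Nonnegligible : 𝒯 → Set
  Nonnegligible D = ∀ η → 0r < η → ¬ (ι 0r ≲ ((- η) ▹ D))

  within⇒nonnegligible : ∀ {D W} → (∀ ε → 0r < ε → Within D ε W) → Nonnegligible D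
  within⇒nonnegligible {D} {W} W≈0 η 0<η 0≲[-η]D = W≴[-η]D (≲-trans W≲ηD (≲-trans ηD≲0 0≲[-η]D))
    where
    W≴[-η]D : ¬ (W ≲ ((- η) ▹ D))
    W≴[-η]D = proj₂ (proj₁ (W≈0 η 0<η))
    W≲ηD : W ≲ (η ▹ D)
    W≲ηD = proj₁ (proj₂ (W≈0 η 0<η))
    ηD≲0 : (η ▹ D) ≲ ι 0r
    ηD≲0 = 0≲⊖⇒≲0 (subst (ι 0r ≲_) (▹-negˡ η D) 0≲[-η]D)

  within-of-bounded : ∀ {D V a} → IsEvent D → Nonnegligible D → 0r ≤ a → ι 0r ≲ V →
    (∀ δ → 0r < δ → V ≲ ((a * δ) ▹ D)) → ∀ ε → 0r < ε → Within D ε V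
  within-of-bounded {D} {V} {a} evD nonnegligible 0≤a 0≲V V≲aδD ε 0<ε
    with divide-by-1+a 0≤a 0<ε
  ... | δ , 0<δ , aδ+δ≡ε = ([-ε]D≲V , V≴[-ε]D) , (V≲εD , εD≴V)
    where
    ε-aδ≡δ : ε + - (a * δ) ≡ δ
    ε-aδ≡δ = trans (cong (_+ - (a * δ)) (sym aδ+δ≡ε)) (ℝ.xyx⁻¹≈y (a * δ) δ)
    aδ-ε≡-δ : a * δ + - ε ≡ - δ
    aδ-ε≡-δ = trans (sym (ℝ.⁻¹-anti-homo‿- ε (a * δ))) (cong -_ ε-aδ≡δ)
    0≲▹D : ∀ {r} → 0r ≤ r → ι 0r ≲ (r ▹ D)
    0≲▹D {r} 0≤r = nonneg-scale D r 0≤r (events-nonneg D evD)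
    [-ε]D≲V : ((- ε) ▹ D) ≲ V
    [-ε]D≲V = ≲-trans (0≲⊖⇒≲0 (subst (ι 0r ≲_) εD≡⊖[-ε]D (0≲▹D (proj₁ 0<ε)))) 0≲V
      where
      εD≡⊖[-ε]D : ε ▹ D ≡ ⊖ ((- ε) ▹ D)
      εD≡⊖[-ε]D = sym (trans (cong ⊖_ (▹-negˡ ε D)) (𝒯.⁻¹-involutive (ε ▹ D)))
    V≴[-ε]D : ¬ (V ≲ ((- ε) ▹ D))
    V≴[-ε]D V≲[-ε]D = nonnegligible ε 0<ε (≲-trans 0≲V V≲[-ε]D)
    V≲εD : V ≲ (ε ▹ D)
    V≲εD = ≲-trans (V≲aδD δ 0<δ)
      (0≲[s-r]▹⇒▹≲▹ (subst (λ t → ι 0r ≲ (t ▹ D)) (sym ε-aδ≡δ) (0≲▹D (proj₁ 0<δ))))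
    εD≴V : ¬ ((ε ▹ D) ≲ V)
    εD≴V εD≲V = nonnegligible δ 0<δ
      (subst (λ t → ι 0r ≲ (t ▹ D)) aδ-ε≡-δ (▹≲▹⇒0≲[s-r]▹ (≲-trans εD≲V (V≲aδD δ 0<δ))))

  ▹-band : ∀ p {D W} → Σ ℝ λ a → 0r ≤ a ×
    (∀ {δ} → ((- δ) ▹ D) ≲ W → W ≲ (δ ▹ D) → (p ▹ W) ≲ ((a * δ) ▹ D))
  ▹-band p {D} {W} with total 0r p
  ... | inj₁ 0≤p = p , 0≤p , λ {δ} _ W≲δD →
    subst ((p ▹ W) ≲_) (sym (▹-assoc p δ D)) (≲-scale 0≤p W≲δD)
  ... | inj₂ p≤0 = - p , x≤0⇒0≤-x p≤0 , λ {δ} [-δ]D≲W _ →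
    subst ((p ▹ W) ≲_) (trans (sym (▹-assoc p (- δ) D)) (cong (_▹ D) (p[-δ]≡[-p]δ δ)))
          (≲-scale-antitone p≤0 [-δ]D≲W)
    where
    p[-δ]≡[-p]δ : ∀ δ → p * (- δ) ≡ (- p) * δ
    p[-δ]≡[-p]δ δ = trans (sym (ℝ.-‿distribʳ-* p δ)) (ℝ.-‿distribˡ-* p δ)

  within-of-dominated : ∀ {D V W p} → IsEvent D → (∀ ε → 0r < ε → Within D ε W) →
    ι 0r ≲ V → V ≲ (p ▹ W) → ∀ ε → 0r < ε → Within D ε V
  within-of-dominated {p = p} evD W≈0 0≲V V≲pW with ▹-band p
  ... | a , 0≤a , pW≲aδD = within-of-bounded evD (within⇒nonnegligible W≈0) 0≤a 0≲V
    λ δ 0<δ → ≲-trans V≲pW (pW≲aδD (proj₁ (proj₁ (W≈0 δ 0<δ))) (proj₁ (proj₂ (W≈0 δ 0<δ))))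

mainTheorem11 : (R : Reals) (𝒜 : Algebra R) →
    let open Reals R in let open Algebra 𝒜 in
    (_≲_ : 𝒯 → 𝒯 → Set) → IsPlausiblePreorder 𝒜 _≲_ →
    (X C D : 𝒯) → IsEvent C → IsEvent D →
    CondExpectationIs 𝒜 _≲_ (X · C) D (fin 0r) →
    ∃ (λ p → Cond 𝒜 _≲_ (C · D) (ι 1r) (p ▹ X)) →
    CondProbabilityIs 𝒜 _≲_ C D (fin 0r)
mainTheorem11 R 𝒜 _≲_ isPlausible X C D evC evD E[XC|D]≡0 (p , 1≲pX) =
  Equivalence.from (condExpectation≡0⇔within C D)
    (within-of-dominated evD (Equivalence.to (condExpectation≡0⇔within (X · C) D) E[XC|D]≡0)
                         (events-nonneg (C · D) (·-event evC evD)) CD≲pXCD)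
  where
  open Reals R hiding (isCommutativeRing)
  open Algebra 𝒜
  open ScalarMultiplicationLemmas R 𝒜
  open PlausiblePreorderLemmas R 𝒜 isPlausible
  open IsPlausiblePreorder isPlausible
  CD≲pXCD : (C · D) ≲ (p ▹ ((X · C) · D))
  CD≲pXCD = subst₂ _≲_ (trans (ι-· 1r (C · D)) (▹-identity (C · D)))
                       (trans (▹-· p X (C · D)) (cong (p ▹_) (sym (𝒯.*-assoc X C D)))) 1≲pX
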